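{- Let $$S=\begin{pmatrix}0&0&1\\ 1&0&-3\\ 0&1&-3\end{pmatrix},\qquad S^*=S^T=\begin{pmatrix}0&1&0\\ 0&0&1\\ 1&-3&-3\end{pmatrix},$$ and for every integer $j$ put $\vec{s}_j=S^j(0,1,0)^T$ and $\vec{s}^*_j=(S^*)^j(1,0,0)^T$. Then for every integer $j$, $$\vec{s}_{ -j}\times\vec{s}_{ -j+1}=\vec{s}^*_j\qquad\text{and}\qquad \vec{s}_{ -j-1}\times\vec{s}_{ -j+1}=-\vec{s}^*_{j-1}+3\vec{s}^*_j,$$ where $\times$ denotes the cross product in $\mathbb{R}^3$. -}

module Defs where

open import Data.Nat using (ℕ; zero; suc)
open import Data.Integer using (ℤ; +_; -[1+_]; _+_; _*_; -_; _-_)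
open import Data.Fin using (Fin; zero; suc)

-- Integer 3-vectors and 3x3 matrices (all entries of S, S⁻¹ are integers,
-- det S = 1, so all vectors s_j, s*_j lie in ℤ³ ⊂ ℝ³).
Vec3 : Set
Vec3 = Fin 3 → ℤ

Mat3 : Set
Mat3 = Fin 3 → Fin 3 → ℤ

vec : ℤ → ℤ → ℤ → Vec3
vec a b c zero = a
vec a b c (suc zero) = b
vec a b c (suc (suc zero)) = c

mat : Vec3 → Vec3 → Vec3 → Mat3
mat r₀ r₁ r₂ i = vec-row i
  where
  vec-row : Fin 3 → Vec3
  vec-row zero = r₀
  vec-row (suc zero) = r₁
  vec-row (suc (suc zero)) = r₂

transpose : Mat3 → Mat3
transpose M i j = M j i

_·_ : Mat3 → Vec3 → Vec3
(M · v) i = M i zero * v zero + M i (suc zero) * v (suc zero) + M i (suc (suc zero)) * v (suc (suc zero))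

S : Mat3
S = mat (vec (+ 0) (+ 0) (+ 1)) (vec (+ 1) (+ 0) (- + 3)) (vec (+ 0) (+ 1) (- + 3))

Sinv : Mat3
Sinv = mat (vec (+ 3) (+ 1) (+ 0)) (vec (+ 3) (+ 0) (+ 1)) (vec (+ 1) (+ 0) (+ 0))

S* : Mat3
S* = transpose S

S*inv : Mat3
S*inv = transpose Sinv

iter : Mat3 → ℕ → Vec3 → Vec3
iter M zero v = v
iter M (suc n) v = M · iter M n v

pow : Mat3 → Mat3 → ℤ → Vec3 → Vec3
pow M Minv (+ n) v = iter M n v
pow M Minv -[1+ n ] v = iter Minv (suc n) v

e₁ e₂ : Vec3
e₁ = vec (+ 1) (+ 0) (+ 0)
e₂ = vec (+ 0) (+ 1) (+ 0)

s : ℤ → Vec3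
s j = pow S Sinv j e₂

s* : ℤ → Vec3
s* j = pow S* S*inv j e₁

_×ᵥ_ : Vec3 → Vec3 → Vec3
u ×ᵥ v = vec (u (suc zero) * v (suc (suc zero)) - u (suc (suc zero)) * v (suc zero))
             (u (suc (suc zero)) * v zero - u zero * v (suc (suc zero)))
             (u zero * v (suc zero) - u (suc zero) * v zero)

_+ᵥ_ : Vec3 → Vec3 → Vec3
(u +ᵥ v) i = u i + v i

_*ᵥ_ : ℤ → Vec3 → Vec3
(c *ᵥ v) i = c * v i

-ᵥ_ : Vec3 → Vec3
(-ᵥ v) i = - v i

infixl 6 _+ᵥ_
infixl 7 _*ᵥ_
infixl 7 _×ᵥ_

-- Since (M u) × (M v) = det M · M⁻ᵀ (u × v) and det S = 1, we get (S u) × (S v) = (S*)⁻¹ (u × v),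
-- hence s_k × s_{k+1} = (S*)^{-k} (s_0 × s_1) = s*_{-k} by induction in both directions from
-- s_0 × s_1 = e₂ × e₃ = e₁.  The characteristic polynomial of S is x³ + 3x² + 3x − 1, so
-- Cayley–Hamilton gives s_{k−1} = s_{k+2} + 3 s_{k+1} + 3 s_k; crossing with s_{k+1} reduces
-- the second identity to the first.
module Submission where

open import Defs
open import Data.Fin using (Fin; zero; suc; _↑ˡ_; _↑ʳ_)
open import Data.Integer using (ℤ; +_; -[1+_]; _+_; _-_; -_; _*_)
open import Data.Integer.Solver using (module +-*-Solver)
open import Data.Nat using (ℕ) renaming (zero to ℕzero; suc to ℕsuc)
import Data.Nat.Properties as ℕ
import Data.Integer.Properties as ℤ
open import Data.Integer.Tactic.RingSolver using (solve-∀)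
open import Data.Product using (_×_; _,_)
open import Data.Vec using (Vec; []; _∷_; _++_)
open import Function using (_∘_)
open import Relation.Binary.PropositionalEquality
  using (_≡_; _≗_; refl; sym; trans; cong; cong₂; subst; _→-setoid_)
open import Relation.Binary.Reasoning.Setoid (Fin 3 →-setoid ℤ)
open +-*-Solver using (Polynomial; con; var; _:+_; _:*_; _:-_; :-_; ⟦_⟧; ⟦_⟧↓; prove)

m-1+1≡m : ∀ m → m - + 1 + + 1 ≡ m
m-1+1≡m = solve-∀

m+1-1≡m : ∀ m → m + + 1 - + 1 ≡ m
m+1-1≡m = solve-∀

ℤ-induction : ∀ {ℓ} (P : ℤ → Set ℓ) → P (+ 0) → (∀ k → P k → P (k + + 1)) →
              (∀ k → P k → P (k - + 1)) → ∀ k → P k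
ℤ-induction P base up down (+ ℕzero)     = base
ℤ-induction P base up down (+ ℕsuc n)    =
  subst P (cong +_ (ℕ.+-comm n 1)) (up (+ n) (ℤ-induction P base up down (+ n)))
ℤ-induction P base up down -[1+ ℕzero ]  = down (+ 0) base
ℤ-induction P base up down -[1+ ℕsuc n ] =
  subst P (cong (λ m → -[1+ ℕsuc m ]) (ℕ.+-identityʳ n))
        (down -[1+ n ] (ℤ-induction P base up down -[1+ n ]))

componentwise : {P : Fin 3 → Set} → P zero × P (suc zero) × P (suc (suc zero)) → ∀ i → P i
componentwise (p₀ , p₁ , p₂) zero             = p₀
componentwise (p₀ , p₁ , p₂) (suc zero)       = p₁
componentwise (p₀ , p₁ , p₂) (suc (suc zero)) = p₂

-- Vectors of polynomials, with syntactic counterparts of the vector operations of Defs: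
-- ⟦ (M ⊙ v) i ⟧ ρ unfolds to (M · ⟦ v ⟧) i, and so on, so a vector identity is checked
-- by the ring solver one component at a time.
Vec3ₚ : ℕ → Set
Vec3ₚ n = Fin 3 → Polynomial n

module _ {n : ℕ} where

  _⊙_ : Mat3 → Vec3ₚ n → Vec3ₚ n
  (M ⊙ v) i = con (M i zero) :* v zero :+ con (M i (suc zero)) :* v (suc zero)
              :+ con (M i (suc (suc zero))) :* v (suc (suc zero))

  _⊗_ : Vec3ₚ n → Vec3ₚ n → Vec3ₚ n
  (u ⊗ v) zero             = u (suc zero) :* v (suc (suc zero)) :- u (suc (suc zero)) :* v (suc zero)
  (u ⊗ v) (suc zero)       = u (suc (suc zero)) :* v zero :- u zero :* v (suc (suc zero))
  (u ⊗ v) (suc (suc zero)) = u zero :* v (suc zero) :- u (suc zero) :* v zero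

  _⊕_ : Vec3ₚ n → Vec3ₚ n → Vec3ₚ n
  (u ⊕ v) i = u i :+ v i

  _⊛_ : Polynomial n → Vec3ₚ n → Vec3ₚ n
  (c ⊛ v) i = c :* v i

  ⊖_ : Vec3ₚ n → Vec3ₚ n
  (⊖ v) i = :- v i

  infixl 6 _⊕_
  infixl 7 _⊛_ _⊗_

  vector-identity : (ρ : Vec ℤ n) (l r : Vec3ₚ n) →
    ⟦ l zero ⟧↓ ρ ≡ ⟦ r zero ⟧↓ ρ → ⟦ l (suc zero) ⟧↓ ρ ≡ ⟦ r (suc zero) ⟧↓ ρ →
    ⟦ l (suc (suc zero)) ⟧↓ ρ ≡ ⟦ r (suc (suc zero)) ⟧↓ ρ →
    ⟦ l zero ⟧ ρ ≡ ⟦ r zero ⟧ ρ × ⟦ l (suc zero) ⟧ ρ ≡ ⟦ r (suc zero) ⟧ ρ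
      × ⟦ l (suc (suc zero)) ⟧ ρ ≡ ⟦ r (suc (suc zero)) ⟧ ρ
  vector-identity ρ l r eq₀ eq₁ eq₂ =
    prove ρ (l zero) (r zero) eq₀ , prove ρ (l (suc zero)) (r (suc zero)) eq₁ ,
    prove ρ (l (suc (suc zero))) (r (suc (suc zero))) eq₂

components : Vec3 → Vec ℤ 3
components x = x zero ∷ x (suc zero) ∷ x (suc (suc zero)) ∷ []

·-cong : ∀ M {u v} → u ≗ v → M · u ≗ M · v
·-cong M {u} {v} u≗v i
  rewrite u≗v zero | u≗v (suc zero) | u≗v (suc (suc zero)) = refl

×ᵥ-cong : ∀ {u u′ v v′} → u ≗ u′ → v ≗ v′ → u ×ᵥ v ≗ u′ ×ᵥ v′
×ᵥ-cong {u} {u′} {v} {v′} u≗u′ v≗v′ i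
  rewrite u≗u′ zero | u≗u′ (suc zero) | u≗u′ (suc (suc zero))
        | v≗v′ zero | v≗v′ (suc zero) | v≗v′ (suc (suc zero)) = refl

×ᵥ-combination : ∀ a b u v w → (w +ᵥ a *ᵥ v +ᵥ b *ᵥ u) ×ᵥ v ≗ -ᵥ (v ×ᵥ w) +ᵥ b *ᵥ (u ×ᵥ v)
×ᵥ-combination a b u v w = componentwise (vector-identity ρ
    ((W ⊕ A ⊛ V ⊕ B ⊛ U) ⊗ V) (⊖ (V ⊗ W) ⊕ B ⊛ (U ⊗ V)) refl refl refl)
  where
  ρ : Vec ℤ 11
  ρ = a ∷ b ∷ components u ++ components v ++ components w
  A B : Polynomial 11
  A = var zero
  B = var (suc zero)
  U V W : Vec3ₚ 11
  U = var ∘ (2 ↑ʳ_) ∘ (_↑ˡ 6)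
  V = var ∘ (5 ↑ʳ_) ∘ (_↑ˡ 3)
  W = var ∘ (8 ↑ʳ_)

module _ {M M⁻¹ : Mat3} (inverseʳ : ∀ x → M · (M⁻¹ · x) ≗ x) where

  pow-suc : ∀ k v → pow M M⁻¹ (k + + 1) v ≗ M · pow M M⁻¹ k v
  pow-suc (+ n)         v i = cong (λ m → iter M m v i) (ℕ.+-comm n 1)
  pow-suc -[1+ ℕzero ]  v i = sym (inverseʳ v i)
  pow-suc -[1+ ℕsuc n ] v i = sym (inverseʳ (iter M⁻¹ (ℕsuc n) v) i)

  pow-pred : (∀ x → M⁻¹ · (M · x) ≗ x) → ∀ k v → pow M M⁻¹ (k - + 1) v ≗ M⁻¹ · pow M M⁻¹ k v
  pow-pred inverseˡ k v = begin
    pow M M⁻¹ (k - + 1) v              ≈⟨ inverseˡ _ ⟨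
    M⁻¹ · (M · pow M M⁻¹ (k - + 1) v)  ≈⟨ ·-cong M⁻¹ (pow-suc (k - + 1) v) ⟨
    M⁻¹ · pow M M⁻¹ (k - + 1 + + 1) v  ≡⟨ cong (λ k′ → M⁻¹ · pow M M⁻¹ k′ v) (m-1+1≡m k) ⟩
    M⁻¹ · pow M M⁻¹ k v                ∎

S-inverseʳ : ∀ x → S · (Sinv · x) ≗ x
S-inverseʳ x = componentwise (vector-identity (components x) (S ⊙ (Sinv ⊙ var)) var refl refl refl)

S-inverseˡ : ∀ x → Sinv · (S · x) ≗ x
S-inverseˡ x = componentwise (vector-identity (components x) (Sinv ⊙ (S ⊙ var)) var refl refl refl)

S*-inverseʳ : ∀ x → S* · (S*inv · x) ≗ x
S*-inverseʳ x = componentwise (vector-identity (components x) (S* ⊙ (S*inv ⊙ var)) var refl refl refl)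

S*-inverseˡ : ∀ x → S*inv · (S* · x) ≗ x
S*-inverseˡ x = componentwise (vector-identity (components x) (S*inv ⊙ (S* ⊙ var)) var refl refl refl)

S·-×ᵥ : ∀ u v → S · u ×ᵥ S · v ≗ S*inv · (u ×ᵥ v)
S·-×ᵥ u v = componentwise (vector-identity (components u ++ components v)
    (S ⊙ U ⊗ S ⊙ V) (S*inv ⊙ (U ⊗ V)) refl refl refl)
  where
  U V : Vec3ₚ 6
  U = var ∘ (_↑ˡ 3)
  V = var ∘ (3 ↑ʳ_)

Sinv·-×ᵥ : ∀ u v → Sinv · u ×ᵥ Sinv · v ≗ S* · (u ×ᵥ v)
Sinv·-×ᵥ u v = componentwise (vector-identity (components u ++ components v)
    (Sinv ⊙ U ⊗ Sinv ⊙ V) (S* ⊙ (U ⊗ V)) refl refl refl)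
  where
  U V : Vec3ₚ 6
  U = var ∘ (_↑ˡ 3)
  V = var ∘ (3 ↑ʳ_)

Sinv-Cayley-Hamilton : ∀ v → Sinv · v ≗ S · (S · v) +ᵥ + 3 *ᵥ S · v +ᵥ + 3 *ᵥ v
Sinv-Cayley-Hamilton v = componentwise (vector-identity (components v)
  (Sinv ⊙ var) (S ⊙ (S ⊙ var) ⊕ con (+ 3) ⊛ S ⊙ var ⊕ con (+ 3) ⊛ var) refl refl refl)

s-suc : ∀ k → s (k + + 1) ≗ S · s k
s-suc k = pow-suc S-inverseʳ k e₂

s-pred : ∀ k → s (k - + 1) ≗ Sinv · s k
s-pred k = pow-pred S-inverseʳ S-inverseˡ k e₂

s*-suc : ∀ k → s* (k + + 1) ≗ S* · s* k
s*-suc k = pow-suc S*-inverseʳ k e₁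

s*-pred : ∀ k → s* (k - + 1) ≗ S*inv · s* k
s*-pred k = pow-pred S*-inverseʳ S*-inverseˡ k e₁

s-recurrence : ∀ k → s (k - + 1) ≗ s (k + + 1 + + 1) +ᵥ + 3 *ᵥ s (k + + 1) +ᵥ + 3 *ᵥ s k
s-recurrence k = begin
  s (k - + 1)                                           ≈⟨ s-pred k ⟩
  Sinv · s k                                            ≈⟨ Sinv-Cayley-Hamilton (s k) ⟩
  S · (S · s k) +ᵥ + 3 *ᵥ S · s k +ᵥ + 3 *ᵥ s k         ≈⟨ shift ⟨
  s (k + + 1 + + 1) +ᵥ + 3 *ᵥ s (k + + 1) +ᵥ + 3 *ᵥ s k ∎
  where
  s[k+2] : s (k + + 1 + + 1) ≗ S · (S · s k)
  s[k+2] i = trans (s-suc (k + + 1) i) (·-cong S (s-suc k) i)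

  shift : s (k + + 1 + + 1) +ᵥ + 3 *ᵥ s (k + + 1) +ᵥ + 3 *ᵥ s k ≗
          S · (S · s k) +ᵥ + 3 *ᵥ S · s k +ᵥ + 3 *ᵥ s k
  shift i = cong₂ (λ x y → x + + 3 * y + + 3 * s k i) (s[k+2] i) (s-suc k i)

s-×ᵥ-consecutive : ∀ k → s k ×ᵥ s (k + + 1) ≗ s* (- k)
s-×ᵥ-consecutive = ℤ-induction (λ k → s k ×ᵥ s (k + + 1) ≗ s* (- k)) base up down
  where
  base : s (+ 0) ×ᵥ s (+ 1) ≗ s* (+ 0)
  base = componentwise (refl , refl , refl)

  up : ∀ k → s k ×ᵥ s (k + + 1) ≗ s* (- k) → s (k + + 1) ×ᵥ s (k + + 1 + + 1) ≗ s* (- (k + + 1))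
  up k ih = begin
    s (k + + 1) ×ᵥ s (k + + 1 + + 1)  ≈⟨ ×ᵥ-cong (s-suc k) (s-suc (k + + 1)) ⟩
    S · s k ×ᵥ S · s (k + + 1)        ≈⟨ S·-×ᵥ (s k) (s (k + + 1)) ⟩
    S*inv · (s k ×ᵥ s (k + + 1))      ≈⟨ ·-cong S*inv ih ⟩
    S*inv · s* (- k)                  ≈⟨ s*-pred (- k) ⟨
    s* (- k - + 1)                    ≡⟨ cong s* (ℤ.neg-distrib-+ k (+ 1)) ⟨
    s* (- (k + + 1))                  ∎

  down : ∀ k → s k ×ᵥ s (k + + 1) ≗ s* (- k) → s (k - + 1) ×ᵥ s (k - + 1 + + 1) ≗ s* (- (k - + 1))
  down k ih = begin
    s (k - + 1) ×ᵥ s (k - + 1 + + 1)  ≡⟨ cong (λ k′ → s (k - + 1) ×ᵥ s k′) k-1+1≡k+1-1 ⟩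
    s (k - + 1) ×ᵥ s (k + + 1 - + 1)  ≈⟨ ×ᵥ-cong (s-pred k) (s-pred (k + + 1)) ⟩
    Sinv · s k ×ᵥ Sinv · s (k + + 1)  ≈⟨ Sinv·-×ᵥ (s k) (s (k + + 1)) ⟩
    S* · (s k ×ᵥ s (k + + 1))         ≈⟨ ·-cong S* ih ⟩
    S* · s* (- k)                     ≈⟨ s*-suc (- k) ⟨
    s* (- k + + 1)                    ≡⟨ cong s* (ℤ.neg-distrib-+ k (- + 1)) ⟨
    s* (- (k - + 1))                  ∎
    where
    k-1+1≡k+1-1 : k - + 1 + + 1 ≡ k + + 1 - + 1
    k-1+1≡k+1-1 = trans (m-1+1≡m k) (sym (m+1-1≡m k))

s-×ᵥ-two-apart : ∀ k → s (k - + 1) ×ᵥ s (k + + 1) ≗ -ᵥ s* (- (k + + 1)) +ᵥ + 3 *ᵥ s* (- k)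
s-×ᵥ-two-apart k = begin
  s (k - + 1) ×ᵥ s (k + + 1)
    ≈⟨ ×ᵥ-cong {v = s (k + + 1)} (s-recurrence k) (λ _ → refl) ⟩
  (s (k + + 1 + + 1) +ᵥ + 3 *ᵥ s (k + + 1) +ᵥ + 3 *ᵥ s k) ×ᵥ s (k + + 1)
    ≈⟨ ×ᵥ-combination (+ 3) (+ 3) (s k) (s (k + + 1)) (s (k + + 1 + + 1)) ⟩
  -ᵥ (s (k + + 1) ×ᵥ s (k + + 1 + + 1)) +ᵥ + 3 *ᵥ (s k ×ᵥ s (k + + 1))
    ≈⟨ (λ i → cong₂ (λ x y → - x + + 3 * y) (s-×ᵥ-consecutive (k + + 1) i) (s-×ᵥ-consecutive k i)) ⟩
  -ᵥ s* (- (k + + 1)) +ᵥ + 3 *ᵥ s* (- k)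
    ∎

mainTheorem4 : (j : ℤ) → (∀ (i : Fin 3) → (s (- j) ×ᵥ s (- j + + 1)) i ≡ s* j i)
    × (∀ (i : Fin 3) → (s (- j - + 1) ×ᵥ s (- j + + 1)) i ≡ ((-ᵥ s* (j - + 1)) +ᵥ (+ 3 *ᵥ s* j)) i)
mainTheorem4 j = consecutive , two-apart
  where
  -[-j+1]≡j-1 : - (- j + + 1) ≡ j - + 1
  -[-j+1]≡j-1 = trans (ℤ.neg-distrib-+ (- j) (+ 1)) (cong (_- + 1) (ℤ.neg-involutive j))

  consecutive : s (- j) ×ᵥ s (- j + + 1) ≗ s* j
  consecutive = begin
    s (- j) ×ᵥ s (- j + + 1)  ≈⟨ s-×ᵥ-consecutive (- j) ⟩
    s* (- - j)                ≡⟨ cong s* (ℤ.neg-involutive j) ⟩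
    s* j                      ∎

  two-apart : s (- j - + 1) ×ᵥ s (- j + + 1) ≗ -ᵥ s* (j - + 1) +ᵥ + 3 *ᵥ s* j
  two-apart = begin
    s (- j - + 1) ×ᵥ s (- j + + 1)                ≈⟨ s-×ᵥ-two-apart (- j) ⟩
    -ᵥ s* (- (- j + + 1)) +ᵥ + 3 *ᵥ s* (- - j)
      ≡⟨ cong₂ (λ k k′ → -ᵥ s* k +ᵥ + 3 *ᵥ s* k′) -[-j+1]≡j-1 (ℤ.neg-involutive j) ⟩
    -ᵥ s* (j - + 1) +ᵥ + 3 *ᵥ s* j                ∎
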